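{- For every $n\geq 1$: (a) if $b$ is a nonempty border of $M_{2n+1}$, then $\phi(b)0$ is a border of $M_{2n+2}$; (b) if $b$ is a nonempty border of $M_{2n+2}$, then $0^{ -1}\phi(b)$ is a border of $M_{2n+3}$; (c) if $b$ is a nonempty border of $M_{2n+3}$, then $\phi^{ -1}(0b)$ is a border of $M_{2n+2}$; (d) if $b$ is a nonempty border of $M_{2n+2}$, then $\phi^{ -1}(b0^{ -1})$ is a border of $M_{2n+1}$ (possibly the empty word).
   Context: Let $\phi$ be the morphism on $\{0,1\}^*$ with $\phi(0)=01$, $\phi(1)=0$; it is injective, and for a word $u$ of the form $u=\phi(v)$ one writes $\phi^{ -1}(u)=v$ (the assertions (c),(d) include that these preimages exist). Finite Fibonacci words: $f_1=1$, $f_2=0$, $f_{n+2}=f_{n+1}f_n$. For $n\geq 3$, $p_n$ is $f_n$ with its last two letters deleted ($p_3=\epsilon$, $p_4=0$, $p_5=010$, ...). The minimal forbidden factors of the infinite Fibonacci word are $M_{2n+1}=1p_{2n+1}1$ and $M_{2n+2}=0p_{2n+2}0$ for $n\geq 1$. A word $b$ is a border of $w$ if $w=xb=by$ for some words $x,y$ (every word is a border of itself). For a word $w$ beginning (resp. ending) with $0$, $0^{ -1}w$ (resp. $w0^{ -1}$) denotes $w$ with its first (resp. last) letter removed. -}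

module Defs where

open import Data.Nat using (ℕ; zero; suc; _+_; _*_)
open import Data.List using (List; []; _∷_; _++_; concatMap; reverse; drop)
open import Data.Product using (∃; ∃₂; _×_; _,_)
open import Relation.Binary.PropositionalEquality using (_≡_)

data Bit : Set where
  𝟘 𝟙 : Bit

Word : Set
Word = List Bit

φ₁ : Bit → Word
φ₁ 𝟘 = 𝟘 ∷ 𝟙 ∷ []
φ₁ 𝟙 = 𝟘 ∷ []

φ : Word → Word
φ = concatMap φ₁

-- finite Fibonacci words, f 1 = 1, f 2 = 0, f (n+2) = f (n+1) f n  (f 0 is unused)
f : ℕ → Word
f zero = []
f (suc zero) = 𝟙 ∷ []
f (suc (suc zero)) = 𝟘 ∷ []
f (suc (suc (suc n))) = f (suc (suc n)) ++ f (suc n)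

-- p n = f n with its last two letters deleted (meaningful for n ≥ 3)
p : ℕ → Word
p n = reverse (drop 2 (reverse (f n)))

-- minimal forbidden factors: M (2n+1) = 1 p_{2n+1} 1, M (2n+2) = 0 p_{2n+2} 0
Modd : ℕ → Word
Modd n = 𝟙 ∷ p (2 * n + 1) ++ 𝟙 ∷ []

Meven : ℕ → Word
Meven n = 𝟘 ∷ p (2 * n + 2) ++ 𝟘 ∷ []

Border : Word → Word → Set
Border b w = (∃ λ x → w ≡ x ++ b) × (∃ λ y → w ≡ b ++ y)

-- Both families of minimal forbidden factors are linked by the Fibonacci morphism:
-- M_{2n+2} = φ(M_{2n+1})0 and φ(M_{2n+2}) = 0M_{2n+3}, since p_{k+1} = φ(p_k)0 for k ≥ 3.
-- Borders are pushed forward through φ directly. To pull a border back, note that a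
-- cut of φ(V) just before a 0 (or at its end) is a cut between images of letters of V,
-- and that every 1 of φ(V) sits right after a 0 and right before such a cut; the two
-- occurrences of the border then come from two occurrences of the same preimage.
module Submission where

open import Defs
open import Data.Nat using (ℕ; zero; suc; _+_; _*_)
open import Data.Nat.Tactic.RingSolver using (solve-∀)
open import Data.List using (List; []; _∷_; _++_; _∷ʳ_; reverse; drop; initLast; _∷ʳ′_)
open import Data.List.Properties
  using (++-assoc; ++-identityʳ; ∷-injectiveʳ; ∷ʳ-injectiveˡ; ∷ʳ-injectiveʳ; concatMap-++; reverse-++; reverse-involutive)
open import Data.Product using (∃; ∃₂; _×_; _,_)
open import Data.Empty using (⊥-elim)
open import Relation.Nullary using (¬_)
open import Relation.Binary.PropositionalEquality using (_≡_; _≢_; refl; sym; trans; cong; cong₂; subst; module ≡-Reasoning)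
open ≡-Reasoning

φ-++ : ∀ u v → φ (u ++ v) ≡ φ u ++ φ v
φ-++ = concatMap-++ φ₁

φ-≢-𝟙∷ : ∀ v {w} → φ v ≢ 𝟙 ∷ w
φ-≢-𝟙∷ []      ()
φ-≢-𝟙∷ (𝟘 ∷ _) ()
φ-≢-𝟙∷ (𝟙 ∷ _) ()

φ-injective : ∀ u v → φ u ≡ φ v → u ≡ v
φ-injective []      []      _  = refl
φ-injective (𝟘 ∷ u) (𝟘 ∷ v) eq = cong (𝟘 ∷_) (φ-injective u v (∷-injectiveʳ (∷-injectiveʳ eq)))
φ-injective (𝟙 ∷ u) (𝟙 ∷ v) eq = cong (𝟙 ∷_) (φ-injective u v (∷-injectiveʳ eq))
φ-injective (𝟘 ∷ u) (𝟙 ∷ v) eq = ⊥-elim (φ-≢-𝟙∷ v (sym (∷-injectiveʳ eq)))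
φ-injective (𝟙 ∷ u) (𝟘 ∷ v) eq = ⊥-elim (φ-≢-𝟙∷ u (∷-injectiveʳ eq))
φ-injective []      (𝟘 ∷ _) ()
φ-injective []      (𝟙 ∷ _) ()
φ-injective (𝟘 ∷ _) []      ()
φ-injective (𝟙 ∷ _) []      ()

-- The words that may follow a cut of φ(V) between images of letters (see φ-split).
data Synchronising : Word → Set where
  empty : Synchronising []
  head𝟘 : ∀ w → Synchronising (𝟘 ∷ w)

φ-synchronising : ∀ v → Synchronising (φ v)
φ-synchronising []      = empty
φ-synchronising (𝟘 ∷ v) = head𝟘 _
φ-synchronising (𝟙 ∷ v) = head𝟘 _

Synchronising-++⁻ˡ : ∀ u {v} → Synchronising (u ++ v) → Synchronising u
Synchronising-++⁻ˡ []      _          = empty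
Synchronising-++⁻ˡ (_ ∷ u) (head𝟘 _) = head𝟘 u

Synchronising-∷ʳ𝟘 : ∀ {y} → Synchronising y → ∃ λ y′ → y ∷ʳ 𝟘 ≡ 𝟘 ∷ y′
Synchronising-∷ʳ𝟘 empty     = [] , refl
Synchronising-∷ʳ𝟘 (head𝟘 y) = y ∷ʳ 𝟘 , refl

Synchronising-cut-𝟘∷ : ∀ {s w u} → Synchronising s → 𝟘 ∷ w ≡ s ++ 𝟘 ∷ u → ∃ λ x → w ≡ x ++ u
Synchronising-cut-𝟘∷         empty     eq = [] , ∷-injectiveʳ eq
Synchronising-cut-𝟘∷ {u = u} (head𝟘 s) eq = s ∷ʳ 𝟘 , trans (∷-injectiveʳ eq) (sym (++-assoc s (𝟘 ∷ []) u))

φ-prefix-synchronising : ∀ V u {v} → φ V ≡ u ++ v → Synchronising u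
φ-prefix-synchronising V u eq = Synchronising-++⁻ˡ u (subst Synchronising eq (φ-synchronising V))

φ-split : ∀ V P {Q} → Synchronising Q → φ V ≡ P ++ Q →
          ∃₂ λ v v′ → V ≡ v ++ v′ × φ v ≡ P × φ v′ ≡ Q
φ-split V [] _ eq = [] , V , refl , refl , eq
φ-split (𝟘 ∷ V) (𝟘 ∷ 𝟙 ∷ P) s eq with φ-split V P s (∷-injectiveʳ (∷-injectiveʳ eq))
... | v , v′ , refl , refl , eq′ = 𝟘 ∷ v , v′ , refl , refl , eq′
φ-split (𝟙 ∷ V) (𝟘 ∷ P) s eq with φ-split V P s (∷-injectiveʳ eq)
... | v , v′ , refl , refl , eq′ = 𝟙 ∷ v , v′ , refl , refl , eq′
φ-split (𝟘 ∷ _) (𝟘 ∷ [])    empty     ()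
φ-split (𝟘 ∷ _) (𝟘 ∷ [])    (head𝟘 _) ()
φ-split (𝟘 ∷ _) (𝟘 ∷ 𝟘 ∷ _) _         ()
φ-split (𝟘 ∷ _) (𝟙 ∷ _)     _         ()
φ-split (𝟙 ∷ _) (𝟙 ∷ _)     _         ()
φ-split []      (_ ∷ _)     _         ()

φ-𝟙-neighbours : ∀ V P {R} → φ V ≡ P ++ 𝟙 ∷ R → (∃ λ P′ → P ≡ P′ ∷ʳ 𝟘) × Synchronising R
φ-𝟙-neighbours (𝟘 ∷ V) (𝟘 ∷ []) eq =
  ([] , refl) , subst Synchronising (∷-injectiveʳ (∷-injectiveʳ eq)) (φ-synchronising V)
φ-𝟙-neighbours (𝟘 ∷ V) (𝟘 ∷ 𝟙 ∷ P) eq with φ-𝟙-neighbours V P (∷-injectiveʳ (∷-injectiveʳ eq))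
... | (P′ , refl) , s = (𝟘 ∷ 𝟙 ∷ P′ , refl) , s
φ-𝟙-neighbours (𝟙 ∷ V) (𝟘 ∷ P) eq with φ-𝟙-neighbours V P (∷-injectiveʳ eq)
... | (P′ , refl) , s = (𝟘 ∷ P′ , refl) , s
φ-𝟙-neighbours []      []          ()
φ-𝟙-neighbours []      (_ ∷ _)     ()
φ-𝟙-neighbours (𝟘 ∷ _) []          ()
φ-𝟙-neighbours (𝟘 ∷ _) (𝟘 ∷ 𝟘 ∷ _) ()
φ-𝟙-neighbours (𝟘 ∷ _) (𝟙 ∷ _)     ()
φ-𝟙-neighbours (𝟙 ∷ _) []          ()
φ-𝟙-neighbours (𝟙 ∷ _) (𝟙 ∷ _)     ()

nonempty-prefix-head : ∀ {a : Bit} {w b y : Word} → ¬ b ≡ [] → a ∷ w ≡ b ++ y → ∃ λ b′ → b ≡ a ∷ b′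
nonempty-prefix-head {b = []}    b≢[] _    = ⊥-elim (b≢[] refl)
nonempty-prefix-head {b = _ ∷ b} _    refl = b , refl

nonempty-suffix-last : ∀ (w : Word) {a} x b → ¬ b ≡ [] → w ∷ʳ a ≡ x ++ b → ∃ λ b′ → b ≡ b′ ∷ʳ a
nonempty-suffix-last w x b b≢[] eq with initLast b
... | []       = ⊥-elim (b≢[] refl)
... | b′ ∷ʳ′ d with refl ← ∷ʳ-injectiveʳ w (x ++ b′) (trans eq (sym (++-assoc x b′ (d ∷ [])))) = b′ , refl

φ-border-∷ʳ𝟘 : ∀ {b w} → Border b w → Border (φ b ∷ʳ 𝟘) (φ w ∷ʳ 𝟘)
φ-border-∷ʳ𝟘 {b} ((x , refl) , (y , x++b≡b++y)) with Synchronising-∷ʳ𝟘 (φ-synchronising y)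
... | y′ , φy∷ʳ𝟘≡𝟘∷y′ = (φ x , suffix) , (y′ , prefix)
  where
  suffix : φ (x ++ b) ∷ʳ 𝟘 ≡ φ x ++ (φ b ∷ʳ 𝟘)
  suffix = trans (cong (_∷ʳ 𝟘) (φ-++ x b)) (++-assoc (φ x) (φ b) (𝟘 ∷ []))
  prefix : φ (x ++ b) ∷ʳ 𝟘 ≡ (φ b ∷ʳ 𝟘) ++ y′
  prefix = begin
    φ (x ++ b) ∷ʳ 𝟘    ≡⟨ cong (λ w → φ w ∷ʳ 𝟘) x++b≡b++y ⟩
    φ (b ++ y) ∷ʳ 𝟘    ≡⟨ cong (_∷ʳ 𝟘) (φ-++ b y) ⟩
    (φ b ++ φ y) ∷ʳ 𝟘  ≡⟨ ++-assoc (φ b) (φ y) (𝟘 ∷ []) ⟩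
    φ b ++ (φ y ∷ʳ 𝟘)  ≡⟨ cong (φ b ++_) φy∷ʳ𝟘≡𝟘∷y′ ⟩
    φ b ++ 𝟘 ∷ y′      ≡⟨ sym (++-assoc (φ b) (𝟘 ∷ []) y′) ⟩
    (φ b ∷ʳ 𝟘) ++ y′   ∎

φ-∷ : ∀ c v → ∃ λ u → φ (c ∷ v) ≡ 𝟘 ∷ u
φ-∷ 𝟘 v = 𝟙 ∷ φ v , refl
φ-∷ 𝟙 v = φ v , refl

φ-border-tail : ∀ {w w′ b} → φ w ≡ 𝟘 ∷ w′ → ¬ b ≡ [] → Border b w →
                ∃ λ u → φ b ≡ 𝟘 ∷ u × Border u w′
φ-border-tail {b = []} _ b≢[] _ = ⊥-elim (b≢[] refl)
φ-border-tail {w} {w′} {c ∷ b} φw≡𝟘∷w′ _ ((x , w≡x++b) , (y , w≡b++y)) with φ-∷ c b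
... | u , φb≡𝟘∷u = u , φb≡𝟘∷u , Synchronising-cut-𝟘∷ (φ-synchronising x) suffix , (φ y , ∷-injectiveʳ prefix)
  where
  suffix : 𝟘 ∷ w′ ≡ φ x ++ 𝟘 ∷ u
  suffix = begin
    𝟘 ∷ w′           ≡⟨ sym φw≡𝟘∷w′ ⟩
    φ w              ≡⟨ cong φ w≡x++b ⟩
    φ (x ++ c ∷ b)   ≡⟨ φ-++ x (c ∷ b) ⟩
    φ x ++ φ (c ∷ b) ≡⟨ cong (φ x ++_) φb≡𝟘∷u ⟩
    φ x ++ 𝟘 ∷ u     ∎
  prefix : 𝟘 ∷ w′ ≡ 𝟘 ∷ u ++ φ y
  prefix = begin
    𝟘 ∷ w′           ≡⟨ sym φw≡𝟘∷w′ ⟩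
    φ w              ≡⟨ cong φ w≡b++y ⟩
    φ (c ∷ b ++ y)   ≡⟨ φ-++ (c ∷ b) y ⟩
    φ (c ∷ b) ++ φ y ≡⟨ cong (_++ φ y) φb≡𝟘∷u ⟩
    𝟘 ∷ u ++ φ y     ∎

φ-border⁻¹ : ∀ {V x b y} → φ V ≡ x ++ b → φ V ≡ b ++ y → Synchronising y →
             ∃ λ v → φ v ≡ b × Border v V
φ-border⁻¹ {V} {x} {b} φV≡x++b φV≡b++y sync-y
  with v , v′ , V≡v++v′ , φv≡b , _ ← φ-split V b sync-y φV≡b++y
  with w , w′ , V≡w++w′ , _ , φw′≡b ← φ-split V x (φ-prefix-synchronising V b φV≡b++y) φV≡x++b
  with refl ← φ-injective w′ v (trans φw′≡b (sym φv≡b))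
  = v , φv≡b , (w , V≡w++w′) , (v′ , V≡v++v′)

φ-border⁻¹-𝟘∷ : ∀ {V L b} → φ V ≡ 𝟘 ∷ 𝟙 ∷ L ++ 𝟙 ∷ [] → ¬ b ≡ [] → Border b (𝟙 ∷ L ++ 𝟙 ∷ []) →
                ∃ λ v → φ v ≡ 𝟘 ∷ b × Border v V
φ-border⁻¹-𝟘∷ {V} {L} φV≡𝟘∷w b≢[] ((x , w≡x++b) , (y , w≡b++y))
  with b₁ , refl ← nonempty-prefix-head b≢[] w≡b++y
  with b₂ , b≡b₂∷ʳ𝟙 ← nonempty-suffix-last (𝟙 ∷ L) x (𝟙 ∷ b₁) b≢[] w≡x++b
  with (x′ , 𝟘∷x≡x′∷ʳ𝟘) , _ ← φ-𝟙-neighbours V (𝟘 ∷ x) (trans φV≡𝟘∷w (cong (𝟘 ∷_) w≡x++b))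
  with _ , sync-y ← φ-𝟙-neighbours V (𝟘 ∷ b₂) (begin
         φ V                    ≡⟨ trans φV≡𝟘∷w (cong (𝟘 ∷_) w≡b++y) ⟩
         𝟘 ∷ (𝟙 ∷ b₁) ++ y      ≡⟨ cong (λ b → 𝟘 ∷ b ++ y) b≡b₂∷ʳ𝟙 ⟩
         𝟘 ∷ (b₂ ∷ʳ 𝟙) ++ y     ≡⟨ cong (𝟘 ∷_) (++-assoc b₂ (𝟙 ∷ []) y) ⟩
         𝟘 ∷ b₂ ++ 𝟙 ∷ y        ∎)
  = φ-border⁻¹ (begin
         φ V                    ≡⟨ trans φV≡𝟘∷w (cong (𝟘 ∷_) w≡x++b) ⟩
         (𝟘 ∷ x) ++ 𝟙 ∷ b₁      ≡⟨ cong (_++ 𝟙 ∷ b₁) 𝟘∷x≡x′∷ʳ𝟘 ⟩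
         (x′ ∷ʳ 𝟘) ++ 𝟙 ∷ b₁    ≡⟨ ++-assoc x′ (𝟘 ∷ []) (𝟙 ∷ b₁) ⟩
         x′ ++ 𝟘 ∷ 𝟙 ∷ b₁       ∎)
       (trans φV≡𝟘∷w (cong (𝟘 ∷_) w≡b++y)) sync-y

∷ʳ-prefix-synchronising : ∀ {w c : Word} {a} y → w ∷ʳ a ≡ (c ∷ʳ 𝟘) ++ y →
                          ∃ λ z → Synchronising z × w ≡ c ++ z
∷ʳ-prefix-synchronising {w} {c} y eq with initLast y
... | []       = [] , empty , ∷ʳ-injectiveˡ w (c ++ []) 
                   (trans eq (trans (++-identityʳ (c ∷ʳ 𝟘)) (cong (_∷ʳ 𝟘) (sym (++-identityʳ c)))))
... | y′ ∷ʳ′ d = 𝟘 ∷ y′ , head𝟘 y′ , ∷ʳ-injectiveˡ w (c ++ 𝟘 ∷ y′) (begin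
  w ∷ʳ _                   ≡⟨ eq ⟩
  (c ∷ʳ 𝟘) ++ (y′ ∷ʳ d)    ≡⟨ ++-assoc c (𝟘 ∷ []) (y′ ∷ʳ d) ⟩
  c ++ 𝟘 ∷ y′ ∷ʳ d         ≡⟨ sym (++-assoc c (𝟘 ∷ y′) (d ∷ [])) ⟩
  (c ++ 𝟘 ∷ y′) ∷ʳ d       ∎)

φ∷ʳ𝟘-border⁻¹ : ∀ {W b} → ¬ b ≡ [] → Border b (φ W ∷ʳ 𝟘) →
                ∃₂ λ c v → b ≡ c ∷ʳ 𝟘 × φ v ≡ c × Border v W
φ∷ʳ𝟘-border⁻¹ {W} {b} b≢[] ((x , φW∷ʳ𝟘≡x++b) , (y , φW∷ʳ𝟘≡b++y))
  with c , refl ← nonempty-suffix-last (φ W) x b b≢[] φW∷ʳ𝟘≡x++b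
  with z , sync-z , φW≡c++z ← ∷ʳ-prefix-synchronising y φW∷ʳ𝟘≡b++y
  with v , φv≡c , v-border ← φ-border⁻¹
         (∷ʳ-injectiveˡ (φ W) (x ++ c) (trans φW∷ʳ𝟘≡x++b (sym (++-assoc x c (𝟘 ∷ [])))))
         φW≡c++z sync-z
  = c , v , refl , φv≡c , v-border

φ-f : ∀ n → φ (f (suc n)) ≡ f (suc (suc n))
φ-f zero          = refl
φ-f (suc zero)    = refl
φ-f (suc (suc n)) = trans (φ-++ (f (suc (suc n))) (f (suc n))) (cong₂ _++_ (φ-f (suc n)) (φ-f n))

fibPrefix : ℕ → Word
fibPrefix zero    = []
fibPrefix (suc k) = φ (fibPrefix k) ∷ʳ 𝟘

flip : Bit → Bit
flip 𝟘 = 𝟙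
flip 𝟙 = 𝟘

φ-flip-pair : ∀ a → φ (a ∷ flip a ∷ []) ≡ 𝟘 ∷ flip a ∷ flip (flip a) ∷ []
φ-flip-pair 𝟘 = refl
φ-flip-pair 𝟙 = refl

f≡fibPrefix++flip-pair : ∀ k → ∃ λ a → f (3 + k) ≡ fibPrefix k ++ a ∷ flip a ∷ []
f≡fibPrefix++flip-pair zero = 𝟘 , refl
f≡fibPrefix++flip-pair (suc k) with a , eq ← f≡fibPrefix++flip-pair k = flip a , (begin
  f (4 + k)                                 ≡⟨ sym (φ-f (2 + k)) ⟩
  φ (f (3 + k))                             ≡⟨ cong φ eq ⟩
  φ (q ++ a ∷ flip a ∷ [])                  ≡⟨ φ-++ q (a ∷ flip a ∷ []) ⟩
  φ q ++ φ (a ∷ flip a ∷ [])                ≡⟨ cong (φ q ++_) (φ-flip-pair a) ⟩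
  φ q ++ 𝟘 ∷ flip a ∷ flip (flip a) ∷ []    ≡⟨ sym (++-assoc (φ q) (𝟘 ∷ []) _) ⟩
  (φ q ∷ʳ 𝟘) ++ flip a ∷ flip (flip a) ∷ [] ∎)
  where q = fibPrefix k

p≡fibPrefix : ∀ k → p (3 + k) ≡ fibPrefix k
p≡fibPrefix k with a , eq ← f≡fibPrefix++flip-pair k = begin
  reverse (drop 2 (reverse (f (3 + k))))                      ≡⟨ cong (λ w → reverse (drop 2 (reverse w))) eq ⟩
  reverse (drop 2 (reverse (q ++ a ∷ flip a ∷ [])))           ≡⟨ cong (λ w → reverse (drop 2 w)) (reverse-++ q (a ∷ flip a ∷ [])) ⟩
  reverse (drop 2 (reverse (a ∷ flip a ∷ []) ++ reverse q))   ≡⟨ reverse-involutive q ⟩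
  q                                                           ∎
  where q = fibPrefix k

p-suc : ∀ k → p (4 + k) ≡ φ (p (3 + k)) ∷ʳ 𝟘
p-suc k = trans (p≡fibPrefix (suc k)) (cong (λ w → φ w ∷ʳ 𝟘) (sym (p≡fibPrefix k)))

Meven≡φModd∷ʳ𝟘 : ∀ m → Meven (suc m) ≡ φ (Modd (suc m)) ∷ʳ 𝟘
Meven≡φModd∷ʳ𝟘 m = begin
  𝟘 ∷ p (2 * suc m + 2) ∷ʳ 𝟘              ≡⟨ cong (λ k → 𝟘 ∷ p k ∷ʳ 𝟘) (index m) ⟩
  𝟘 ∷ p (4 + 2 * m) ∷ʳ 𝟘                  ≡⟨ cong (λ w → 𝟘 ∷ w ∷ʳ 𝟘) (p-suc (2 * m)) ⟩
  𝟘 ∷ (φ P ∷ʳ 𝟘) ∷ʳ 𝟘                     ≡⟨ cong (λ w → 𝟘 ∷ w ∷ʳ 𝟘) (sym (φ-++ P (𝟙 ∷ []))) ⟩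
  φ (𝟙 ∷ P ∷ʳ 𝟙) ∷ʳ 𝟘                     ≡⟨ cong (λ k → φ (𝟙 ∷ p k ∷ʳ 𝟙) ∷ʳ 𝟘) (sym (index′ m)) ⟩
  φ (𝟙 ∷ p (2 * suc m + 1) ∷ʳ 𝟙) ∷ʳ 𝟘     ∎
  where
  P = p (3 + 2 * m)
  index : ∀ m → 2 * suc m + 2 ≡ 4 + 2 * m
  index = solve-∀
  index′ : ∀ m → 2 * suc m + 1 ≡ 3 + 2 * m
  index′ = solve-∀

φMeven≡𝟘∷Modd : ∀ m → φ (Meven (suc m)) ≡ 𝟘 ∷ Modd (suc (suc m))
φMeven≡𝟘∷Modd m = begin
  𝟘 ∷ 𝟙 ∷ φ (P ∷ʳ 𝟘)                      ≡⟨ cong (λ w → 𝟘 ∷ 𝟙 ∷ w) (φ-++ P (𝟘 ∷ [])) ⟩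
  𝟘 ∷ 𝟙 ∷ φ P ++ 𝟘 ∷ 𝟙 ∷ []               ≡⟨ cong (λ w → 𝟘 ∷ 𝟙 ∷ w) (sym (++-assoc (φ P) (𝟘 ∷ []) (𝟙 ∷ []))) ⟩
  𝟘 ∷ 𝟙 ∷ (φ P ∷ʳ 𝟘) ∷ʳ 𝟙                 ≡⟨ cong (λ k → 𝟘 ∷ 𝟙 ∷ φ (p k) ∷ʳ 𝟘 ∷ʳ 𝟙) (index m) ⟩
  𝟘 ∷ 𝟙 ∷ (φ (p (3 + suc (2 * m))) ∷ʳ 𝟘) ∷ʳ 𝟙  ≡⟨ cong (λ w → 𝟘 ∷ 𝟙 ∷ w ∷ʳ 𝟙) (sym (p-suc (suc (2 * m)))) ⟩
  𝟘 ∷ 𝟙 ∷ p (4 + suc (2 * m)) ∷ʳ 𝟙       ≡⟨ cong (λ k → 𝟘 ∷ 𝟙 ∷ p k ∷ʳ 𝟙) (sym (index′ m)) ⟩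
  𝟘 ∷ 𝟙 ∷ p (2 * suc (suc m) + 1) ∷ʳ 𝟙   ∎
  where
  P = p (2 * suc m + 2)
  index : ∀ m → 2 * suc m + 2 ≡ 3 + suc (2 * m)
  index = solve-∀
  index′ : ∀ m → 2 * suc (suc m) + 1 ≡ 4 + suc (2 * m)
  index′ = solve-∀

lemma6 : ∀ (m : ℕ) → let n = suc m in
    (∀ (b : Word) → ¬ b ≡ [] → Border b (Modd n) → Border (φ b ++ 𝟘 ∷ []) (Meven n))
    × (∀ (b : Word) → ¬ b ≡ [] → Border b (Meven n) →
         ∃ λ u → φ b ≡ 𝟘 ∷ u × Border u (Modd (suc n)))
    × (∀ (b : Word) → ¬ b ≡ [] → Border b (Modd (suc n)) →
         ∃ λ v → φ v ≡ 𝟘 ∷ b × Border v (Meven n))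
    × (∀ (b : Word) → ¬ b ≡ [] → Border b (Meven n) →
         ∃₂ λ c v → b ≡ c ++ 𝟘 ∷ [] × φ v ≡ c × Border v (Modd n))
lemma6 m =
    (λ b _ b-border → subst (Border (φ b ∷ʳ 𝟘)) (sym (Meven≡φModd∷ʳ𝟘 m)) (φ-border-∷ʳ𝟘 b-border))
  , (λ _ b≢[] → φ-border-tail (φMeven≡𝟘∷Modd m) b≢[])
  , (λ _ b≢[] → φ-border⁻¹-𝟘∷ (φMeven≡𝟘∷Modd m) b≢[])
  , (λ b b≢[] b-border → φ∷ʳ𝟘-border⁻¹ b≢[] (subst (Border b) (Meven≡φModd∷ʳ𝟘 m) b-border))
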